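{- Let $n,s,k$ be positive integers with $1 \leq k < n$. If either (1) $1 \leq s < \frac{k}{2}$, or (2) $\gcd(s,k)=1$ and $\frac{k}{2} \leq s < k-1$, then there exists an $s$-overlap cycle on the set of all $k$-permutations of $[n]=\{1,2,\ldots,n\}$.
   Context: A $k$-permutation of $[n]$ is a string $a_1a_2\ldots a_k$ of $k$ pairwise distinct elements of $[n]$. For a finite set $\mathcal{C}$ of strings, each of length $k$, and an integer $1 \le s < k$, an $s$-overlap cycle ($s$-ocycle) on $\mathcal{C}$ is a cyclic ordering $c^{(1)}, \ldots, c^{(N)}$ of all elements of $\mathcal{C}$, each appearing exactly once, such that for every $j$ (indices taken cyclically, so $c^{(N)}$ is followed by $c^{(1)}$), the last $s$ letters of $c^{(j)}$ equal the first $s$ letters of $c^{(j+1)}$; that is, if $a=a_1\ldots a_k$ is followed by $b=b_1\ldots b_k$ then $a_{k-s+1}\ldots a_k = b_1\ldots b_s$. -}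

module Defs where

open import Data.Nat using (ℕ; _∸_)
open import Data.Fin using (Fin)
open import Data.List using (List; []; _∷_; _++_; [_]; length; drop; take)
open import Data.List.Relation.Unary.Unique.Propositional using (Unique)
open import Data.List.Relation.Unary.All using (All)
open import Data.List.Membership.Propositional using (_∈_)
open import Data.Product using (_×_)
open import Data.Unit using (⊤)
open import Relation.Binary.PropositionalEquality using (_≡_)

-- Strings over [n] are lists of elements of Fin n (Fin n ≅ {1,…,n}).

IsKPerm : (n k : ℕ) → List (Fin n) → Set
IsKPerm n k w = (length w ≡ k) × Unique w

-- for strings a, b of length k: the last s letters of a equal the first s letters of b
Overlap : {A : Set} → (k s : ℕ) → List A → List A → Set
Overlap k s a b = drop (k ∸ s) a ≡ take s b

data Linked {A : Set} (R : A → A → Set) : List A → Set where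
  [] : Linked R []
  [-] : ∀ {x} → Linked R (x ∷ [])
  _∷_ : ∀ {x y xs} → R x y → Linked R (y ∷ xs) → Linked R (x ∷ y ∷ xs)

CyclicLinked : {A : Set} → (R : A → A → Set) → List A → Set
CyclicLinked R [] = ⊤
CyclicLinked R (x ∷ xs) = Linked R ((x ∷ xs) ++ [ x ])

IsOCycle : {A : Set} → (k s : ℕ) → (P : List A → Set) → List (List A) → Set
IsOCycle k s P cs =
  Unique cs × All P cs × (∀ w → P w → w ∈ cs) × CyclicLinked (Overlap k s) cs

module Submission where

-- An s-overlap cycle on the k-permutations of [n] is an Eulerian circuit in
-- the graph whose vertices are words of length s and in which a k-permutation
-- w is an edge from its first s letters to its last s letters.  We build it
-- as Hierholzer's algorithm does, from a decomposition into closed trails: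
-- the rotation σ moving the first k − s letters of w to the end satisfies
-- last_s(w) = first_s(σ w), so the σ-orbits are closed trails.  Splicing
-- orbits together at common vertices yields an Eulerian circuit as soon as
-- the k-permutations are connected by σ-steps and by exchanging words with
-- equal s-prefix (module EulerianCycle, for an arbitrary edge set).
--
-- Connectivity is reduced to a replacement walk (module ReplacementWalk):
-- any m-permutation can be turned into any other, m < n, by repeatedly
-- replacing one letter by a letter not in the word.  If 2s < k, such
-- replacements are realised on s-prefixes by jumping through words
-- u ++ z ++ v whose σ-image begins with v; if gcd(s, k) = 1, a power of σ is
-- rotation by one letter (Bézout), so any letter can be moved to the last
-- position, outside the prefix, and replaced there.

open import Defs
open import Data.Nat using (ℕ; zero; suc; _+_; _*_; _∸_; _≤_; _<_; _⊓_; z≤n; s≤s)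
open import Data.Nat.Properties
open import Data.Nat.Tactic.RingSolver using (solve-∀)
open import Data.Nat.GCD using (gcd; module Bézout)
open import Data.Nat.Coprimality using (Coprime; coprime-Bézout; gcd≡1⇒coprime)
open import Data.Nat.Divisibility using (_∣_; ∣m+n∣m⇒∣n)
open import Data.Nat.GeneralisedArithmetic using (iterate)
open import Data.Fin using (Fin) renaming (_≟_ to _≟ᶠ_)
open import Data.List using (List; []; _∷_; _++_; [_]; length; take; drop; allFin; map; concatMap)
  renaming (iterate to trajectory)
open import Data.List.Properties
  using (++-assoc; ++-identityʳ; length-++; length-take; length-drop; length-tabulate; take++drop≡id; ≡-dec)
open import Data.List.Membership.Propositional using (_∈_; _∉_; find; lose)
open import Data.List.Membership.Propositional.Properties
  using (∈-∃++; ∈-allFin; ∈-++⁺ˡ; ∈-++⁺ʳ; ∈-++⁻; ∈-map⁺; ∈-concat⁺′)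
open import Data.List.Relation.Unary.Any using (Any; here; there; any?)
open import Data.List.Relation.Unary.All using (All; []; _∷_; tabulate; lookup)
open import Data.List.Relation.Unary.All.Properties using (¬Any⇒All¬; All¬⇒¬Any)
open import Data.List.Relation.Unary.AllPairs using ([]; _∷_)
open import Data.List.Relation.Unary.Unique.Propositional using (Unique)
import Data.List.Relation.Unary.Unique.Propositional.Properties as Unique
open import Data.List.Relation.Binary.Disjoint.Propositional using (Disjoint)
open import Data.List.Relation.Binary.Permutation.Propositional using (_↭_; ↭-sym; ↭-trans; ↭-refl; ↭⇒↭ₛ)
open import Data.List.Relation.Binary.Permutation.Propositional.Properties
  using (∈-resp-↭; shift; shifts; ↭-length; ∷↭∷ʳ; ++-comm)
open import Data.List.Relation.Binary.Permutation.Setoid.Properties using (Unique-resp-↭)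
open import Data.Product using (Σ; ∃; ∃₂; _×_; _,_; proj₁; proj₂)
open import Data.Sum using (_⊎_; inj₁; inj₂; [_,_]′)
open import Data.Empty using (⊥-elim)
open import Function using (_∘_)
open import Relation.Nullary using (¬_; ¬?; Dec; yes; no)
open import Relation.Nullary.Decidable using (_×-dec_; decidable-stable)
open import Relation.Unary using (Decidable)
open import Relation.Binary.Definitions using (DecidableEquality)
open import Relation.Binary.PropositionalEquality hiding ([_])

iterate-+ : {A : Set} (f : A → A) (x : A) (a b : ℕ) →
            iterate f x (a + b) ≡ iterate f (iterate f x a) b
iterate-+ f x zero    b = refl
iterate-+ f x (suc a) b = iterate-+ f (f x) a b

iterate-* : {A : Set} (f : A → A) (a : ℕ) (x : A) (b : ℕ) →
            iterate (λ y → iterate f y a) x b ≡ iterate f x (b * a)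
iterate-* f a x zero    = refl
iterate-* f a x (suc b) = trans (iterate-* f a (iterate f x a) b) (sym (iterate-+ f x a (b * a)))

iterate-preserves : {A : Set} {Q : A → Set} (f : A → A) → (∀ {x} → Q x → Q (f x)) →
                    ∀ {x} a → Q x → Q (iterate f x a)
iterate-preserves f pres zero    q = q
iterate-preserves {Q = Q} f pres (suc a) q = iterate-preserves {Q = Q} f pres a (pres q)

iterate-suc : {A : Set} (f : A → A) (x : A) (a : ℕ) → iterate f x (suc a) ≡ f (iterate f x a)
iterate-suc f x a = trans (cong (iterate f x) (+-comm 1 a)) (iterate-+ f x a 1)

∈-trajectory⁻ : {A : Set} (f : A → A) {x y : A} (m : ℕ) → y ∈ trajectory f x m →
                ∃ λ j → j < m × y ≡ iterate f x j
∈-trajectory⁻ f (suc m) (here refl) = 0 , s≤s z≤n , refl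
∈-trajectory⁻ f (suc m) (there y∈) with ∈-trajectory⁻ f m y∈
... | j , j<m , y≡ = suc j , s≤s j<m , y≡

∈-trajectory⁺ : {A : Set} (f : A → A) (x : A) {j m : ℕ} → j < m → iterate f x j ∈ trajectory f x m
∈-trajectory⁺ f x {zero}  {suc m} _         = here refl
∈-trajectory⁺ f x {suc j} {suc m} (s≤s j<m) = there (∈-trajectory⁺ f (f x) j<m)

trajectory-unique : {A : Set} (f : A → A) (x : A) (m : ℕ) →
                    (∀ i d → i + suc d < m → iterate f x i ≢ iterate f x (i + suc d)) →
                    Unique (trajectory f x m)
trajectory-unique f x zero    _        = []
trajectory-unique f x (suc m) distinct =
  tabulate x∉ ∷
  trajectory-unique f (f x) m (λ i d lt → distinct (suc i) d (s≤s lt))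
  where
  x∉ : ∀ {y} → y ∈ trajectory f (f x) m → x ≢ y
  x∉ y∈ x≡y with ∈-trajectory⁻ f m y∈
  ... | d , d<m , y≡ = distinct 0 d (s≤s d<m) (trans x≡y y≡)

least-witness : {Q : ℕ → Set} → Decidable Q → ∀ {K} → Q K →
                ∃ λ m → Q m × (∀ {j} → j < m → ¬ Q j)
least-witness Q? {zero} q = 0 , q , λ ()
least-witness Q? {suc K} q with Q? 0
... | yes q₀ = 0 , q₀ , λ ()
... | no ¬q₀ with least-witness (λ j → Q? (suc j)) q
...   | m , qm , below = suc m , qm , λ { {zero} _ → ¬q₀ ; {suc j} (s≤s j<m) → below j<m }

unique-↭ : {A : Set} {xs ys : List A} → xs ↭ ys → Unique xs → Unique ys
unique-↭ {A} p = Unique-resp-↭ (setoid A) (↭⇒↭ₛ p)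

↭-IsKPerm : ∀ {n k} {xs ys : List (Fin n)} → xs ↭ ys → IsKPerm n k xs → IsKPerm n k ys
↭-IsKPerm p (len , u) = trans (sym (↭-length p)) len , unique-↭ p u

unique-middle⁻ : {A : Set} {x : A} (X Y : List A) →
                 Unique (X ++ x ∷ Y) → x ∉ X ++ Y × Unique (X ++ Y)
unique-middle⁻ {x = x} X Y u with unique-↭ (shift x X Y) u
... | x∉ ∷ uXY = All¬⇒¬Any x∉ , uXY

unique-middle⁺ : {A : Set} {x : A} (X Y : List A) →
                 x ∉ X ++ Y → Unique (X ++ Y) → Unique (X ++ x ∷ Y)
unique-middle⁺ {x = x} X Y x∉ u = unique-↭ (↭-sym (shift x X Y)) (¬Any⇒All¬ _ x∉ ∷ u)

∈-middle⁺ : {A : Set} {x z : A} (X Y : List A) → z ∈ X ++ Y → z ∈ X ++ x ∷ Y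
∈-middle⁺ {x = x} X Y z∈ = ∈-resp-↭ (↭-sym (shift x X Y)) (there z∈)

∈-middle⁻ : {A : Set} {x z : A} (X Y : List A) → z ∈ X ++ x ∷ Y → z ≢ x → z ∈ X ++ Y
∈-middle⁻ {x = x} X Y z∈ z≢x with ∈-resp-↭ (shift x X Y) z∈
... | here z≡x = ⊥-elim (z≢x z≡x)
... | there z∈XY = z∈XY

replace-IsKPerm : ∀ {n k} {x y : Fin n} (X Y : List (Fin n)) →
                  IsKPerm n k (X ++ x ∷ Y) → y ∉ X ++ Y → IsKPerm n k (X ++ y ∷ Y)
replace-IsKPerm X Y (len , u) y∉ =
  trans (trans (length-++ X) (sym (length-++ X))) len ,
  unique-middle⁺ X Y y∉ (proj₂ (unique-middle⁻ X Y u))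

unique-⊆-length : {A : Set} {xs ys : List A} → Unique xs → (∀ {z} → z ∈ xs → z ∈ ys) →
                  length xs ≤ length ys
unique-⊆-length {xs = []} _ _ = z≤n
unique-⊆-length {xs = x ∷ xs} (x∉xs ∷ u) xs⊆ys with ∈-∃++ (xs⊆ys (here refl))
... | Y₁ , Y₂ , refl = subst (suc (length xs) ≤_) (sym (↭-length (shift x Y₁ Y₂)))
                         (s≤s (unique-⊆-length u xs⊆Y₁Y₂))
  where
  xs⊆Y₁Y₂ : ∀ {z} → z ∈ xs → z ∈ Y₁ ++ Y₂
  xs⊆Y₁Y₂ z∈ = ∈-middle⁻ Y₁ Y₂ (xs⊆ys (there z∈))
                 (λ z≡x → lookup x∉xs z∈ (sym z≡x))

module _ {n : ℕ} where
  open import Data.List.Membership.DecPropositional (_≟ᶠ_ {n}) using (_∈?_)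

  fresh-letter : (xs : List (Fin n)) → length xs < n → ∃ λ a → a ∉ xs
  fresh-letter xs short with any? (λ a → ¬? (a ∈? xs)) (allFin n)
  ... | yes found = let a , _ , a∉ = find found in a , a∉
  ... | no none = ⊥-elim (<⇒≱ short (subst (_≤ length xs) (length-tabulate (λ a → a))
                                        (unique-⊆-length (Unique.allFin⁺ n) all-in)))
    where
    all-in : ∀ {a} → a ∈ allFin n → a ∈ xs
    all-in {a} a∈ = decidable-stable (a ∈? xs) (λ a∉ → none (lose a∈ a∉))

  fresh-word : (m : ℕ) (xs : List (Fin n)) → m + length xs ≤ n →
               ∃ λ z → IsKPerm n m z × Disjoint z xs
  fresh-word zero    xs room = [] , (refl , []) , λ ()
  fresh-word (suc m) xs room with fresh-letter xs (≤-trans (s≤s (m≤n+m (length xs) m)) room)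
  ... | a , a∉xs with fresh-word m (a ∷ xs) (subst (_≤ n) (sym (+-suc m (length xs))) room)
  ...   | z , (len , u) , z#axs = a ∷ z , (cong suc len , ¬Any⇒All¬ z a∉z ∷ u) , a∷z#xs
    where
    a∉z : a ∉ z
    a∉z a∈z = z#axs (a∈z , here refl)
    a∷z#xs : Disjoint (a ∷ z) xs
    a∷z#xs (here refl , b∈xs) = a∉xs b∈xs
    a∷z#xs (there b∈z , b∈xs) = z#axs (b∈z , there b∈xs)

rotate₁ : {A : Set} → List A → List A
rotate₁ []       = []
rotate₁ (x ∷ xs) = xs ++ [ x ]

rotate : {A : Set} → ℕ → List A → List A
rotate m w = iterate rotate₁ w m

rotate-↭ : {A : Set} (m : ℕ) (w : List A) → w ↭ rotate m w
rotate-↭ zero    w        = ↭-refl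
rotate-↭ (suc m) []       = rotate-↭ m []
rotate-↭ (suc m) (x ∷ xs) = ↭-trans (∷↭∷ʳ x xs) (rotate-↭ m (xs ++ [ x ]))

rotate-++ : {A : Set} (X Y : List A) → rotate (length X) (X ++ Y) ≡ Y ++ X
rotate-++ []      Y = sym (++-identityʳ Y)
rotate-++ (x ∷ X) Y = begin
  rotate (length X) ((X ++ Y) ++ [ x ]) ≡⟨ cong (rotate (length X)) (++-assoc X Y [ x ]) ⟩
  rotate (length X) (X ++ Y ++ [ x ])   ≡⟨ rotate-++ X (Y ++ [ x ]) ⟩
  (Y ++ [ x ]) ++ X                     ≡⟨ ++-assoc Y [ x ] X ⟩
  Y ++ x ∷ X                            ∎
  where open ≡-Reasoning

rotate-multiple : {A : Set} (q : ℕ) (w : List A) → rotate (q * length w) w ≡ w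
rotate-multiple zero    w = refl
rotate-multiple (suc q) w = begin
  rotate (length w + q * length w) w       ≡⟨ iterate-+ rotate₁ w (length w) (q * length w) ⟩
  rotate (q * length w) (rotate (length w) w) ≡⟨ cong (rotate (q * length w)) full ⟩
  rotate (q * length w) w                  ≡⟨ rotate-multiple q w ⟩
  w                                        ∎
  where
  open ≡-Reasoning
  full : rotate (length w) w ≡ w
  full = trans (cong (rotate (length w)) (sym (++-identityʳ w))) (rotate-++ w [])

rotate-split : {A : Set} (m : ℕ) (w : List A) → m ≤ length w → rotate m w ≡ drop m w ++ take m w
rotate-split m w m≤ = begin
  rotate m w                              ≡⟨ cong (rotate m) (sym (take++drop≡id m w)) ⟩
  rotate m (take m w ++ drop m w)          ≡⟨ cong (λ i → rotate i (take m w ++ drop m w)) (sym len) ⟩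
  rotate (length (take m w)) (take m w ++ drop m w) ≡⟨ rotate-++ (take m w) (drop m w) ⟩
  drop m w ++ take m w                     ∎
  where
  open ≡-Reasoning
  len : length (take m w) ≡ m
  len = trans (length-take m w) (m≤n⇒m⊓n≡m m≤)

take-++ : {A : Set} (X Y : List A) → take (length X) (X ++ Y) ≡ X
take-++ []      Y = refl
take-++ (x ∷ X) Y = cong (x ∷_) (take-++ X Y)

take-++-≤ : {A : Set} (m : ℕ) (X Y : List A) → m ≤ length X → take m (X ++ Y) ≡ take m X
take-++-≤ zero    X       Y _        = refl
take-++-≤ (suc m) (x ∷ X) Y (s≤s m≤) = cong (x ∷_) (take-++-≤ m X Y m≤)

-- Eulerian cycles from a cycle decomposition (Hierholzer's splicing).
--
-- A permutation f of the
-- edges with head x ≡ tail (f x) splits them into closed trails, its orbits.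
-- If the edges are connected by f-steps and by passing between edges with a
-- common tail, repeatedly splicing an orbit into a growing closed trail at a
-- shared tail vertex exhausts all edges.
module EulerianCycle
  {E V : Set} (_≟ₑ_ : DecidableEquality E) (_≟ᵥ_ : DecidableEquality V)
  (tail head : E → V)
  (P : E → Set) (P? : Decidable P)
  (enum : List E) (enum-complete : ∀ {x} → P x → x ∈ enum)
  (f : E → E) (f-P : ∀ {x} → P x → P (f x)) (f-link : ∀ {x} → P x → head x ≡ tail (f x))
  (period : ℕ) (f-periodic : ∀ {x} → P x → iterate f x (suc period) ≡ x)
  where

  open import Data.List.Membership.DecPropositional _≟ₑ_ using (_∈?_)

  IsEulerianCycle : List E → Set
  IsEulerianCycle cs = Unique cs × All P cs × (∀ x → P x → x ∈ cs) ×
                       CyclicLinked (λ a b → head a ≡ tail b) cs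

  Connected : Set₁
  Connected = (S : E → Set) → (∀ {x} → P x → S x → S (f x)) →
              (∀ {x y} → P x → P y → tail x ≡ tail y → S x → S y) →
              ∀ {x y} → P x → P y → S x → S y

  Trail : V → List E → V → Set
  Trail u []       v = u ≡ v
  Trail u (e ∷ es) v = tail e ≡ u × Trail (head e) es v

  trail-++ : ∀ {u v w} xs {ys} → Trail u xs v → Trail v ys w → Trail u (xs ++ ys) w
  trail-++ []       refl         t = t
  trail-++ (x ∷ xs) (tx , t₁)    t = tx , trail-++ xs t₁ t

  trail-split : ∀ {u w} xs ys → Trail u (xs ++ ys) w → ∃ λ v → Trail u xs v × Trail v ys w
  trail-split []       ys t = _ , refl , t
  trail-split (x ∷ xs) ys (tx , t) with trail-split xs ys t
  ... | v , t₁ , t₂ = v , (tx , t₁) , t₂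

  trail-linked : ∀ {u v} x xs y → Trail u (x ∷ xs) v → tail y ≡ v →
                 Linked (λ a b → head a ≡ tail b) ((x ∷ xs) ++ [ y ])
  trail-linked x []        y (_ , refl)   ty = sym ty ∷ [-]
  trail-linked x (x′ ∷ xs) y (_ , tx′ , t) ty = sym tx′ ∷ trail-linked x′ xs y (tx′ , t) ty

  closed-trail-cyclic : ∀ {u} xs → Trail u xs u → CyclicLinked (λ a b → head a ≡ tail b) xs
  closed-trail-cyclic []       _ = _
  closed-trail-cyclic (x ∷ xs) t = trail-linked x xs x t (proj₁ t)

  -- f is injective on P: f^period inverts it
  f-injective : ∀ {x y} → P x → P y → f x ≡ f y → x ≡ y
  f-injective {x} {y} px py fx≡fy = begin
    x                        ≡⟨ sym (f-periodic px) ⟩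
    iterate f (f x) period   ≡⟨ cong (λ z → iterate f z period) fx≡fy ⟩
    iterate f (f y) period   ≡⟨ f-periodic py ⟩
    y                        ∎
    where open ≡-Reasoning

  iterate-injective : ∀ {x y} a → P x → P y → iterate f x a ≡ iterate f y a → x ≡ y
  iterate-injective zero    px py e = e
  iterate-injective (suc a) px py e = f-injective px py (iterate-injective a (f-P px) (f-P py) e)

  trajectory-trail : ∀ {x} i → P x → Trail (tail x) (trajectory f x i) (tail (iterate f x i))
  trajectory-trail zero          px = refl
  trajectory-trail {x} (suc i)   px =
    refl , subst (λ u → Trail u (trajectory f (f x) i) (tail (iterate f (f x) i)))
                 (sym (f-link px)) (trajectory-trail i (f-P px))

  module Orbit {x : E} (px : P x) where

    private
      least : ∃ λ m → iterate f x (suc m) ≡ x × (∀ {j} → j < m → iterate f x (suc j) ≢ x)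
      least = least-witness {Q = λ j → iterate f x (suc j) ≡ x} (λ j → iterate f x (suc j) ≟ₑ x)
                            {period} (f-periodic px)

    -- the least period is suc m₀
    m₀ : ℕ
    m₀ = proj₁ least

    returns : iterate f x (suc m₀) ≡ x
    returns = proj₁ (proj₂ least)

    edges : List E
    edges = trajectory f x (suc m₀)

    sound : ∀ {y} → y ∈ edges → P y
    sound y∈ with ∈-trajectory⁻ f (suc m₀) y∈
    ... | j , _ , refl = iterate-preserves {Q = P} f f-P j px

    unique : Unique edges
    unique = trajectory-unique f x (suc m₀) distinct
      where
      distinct : ∀ i d → i + suc d < suc m₀ → iterate f x i ≢ iterate f x (i + suc d)
      distinct i d (s≤s lt) e = proj₂ (proj₂ least) (≤-trans (m≤n+m (suc d) i) lt) (sym x≡)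
        where
        x≡ : x ≡ iterate f x (suc d)
        x≡ = iterate-injective i px (iterate-preserves {Q = P} f f-P (suc d) px) (begin
          iterate f x i                           ≡⟨ e ⟩
          iterate f x (i + suc d)                 ≡⟨ cong (iterate f x) (+-comm i (suc d)) ⟩
          iterate f x (suc d + i)                 ≡⟨ iterate-+ f x (suc d) i ⟩
          iterate f (iterate f x (suc d)) i       ∎)
          where open ≡-Reasoning

    f-closed : ∀ {y} → y ∈ edges → f y ∈ edges
    f-closed y∈ with ∈-trajectory⁻ f (suc m₀) y∈
    ... | j , s≤s j≤m₀ , refl with m≤n⇒m<n∨m≡n j≤m₀
    ...   | inj₁ j<m₀  = subst (_∈ edges) (iterate-suc f x j) (∈-trajectory⁺ f x (s≤s j<m₀))
    ...   | inj₂ refl  = subst (_∈ edges) (trans (sym returns) (iterate-suc f x j)) (here refl)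

    leads-back : ∀ {y} → y ∈ edges → ∃ λ j → iterate f y j ≡ x
    leads-back y∈ with ∈-trajectory⁻ f (suc m₀) y∈
    ... | j , j<m , refl = suc m₀ ∸ j , (begin
      iterate f (iterate f x j) (suc m₀ ∸ j) ≡⟨ sym (iterate-+ f x j (suc m₀ ∸ j)) ⟩
      iterate f x (j + (suc m₀ ∸ j))        ≡⟨ cong (iterate f x) (m+[n∸m]≡n (<⇒≤ j<m)) ⟩
      iterate f x (suc m₀)                  ≡⟨ returns ⟩
      x                                     ∎)
      where open ≡-Reasoning

    closed-trail : Trail (tail x) edges (tail x)
    closed-trail = subst (λ v → Trail (tail x) edges (tail v)) returns (trajectory-trail (suc m₀) px)

  record Partial : Set where
    field
      edges        : List E
      base         : V
      closed-trail : Trail base edges base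
      unique       : Unique edges
      sound        : ∀ {y} → y ∈ edges → P y
      f-closed     : ∀ {y} → y ∈ edges → f y ∈ edges

  orbit-partial : ∀ {x} → P x → Partial
  orbit-partial {x} px = record
    { edges = O.edges ; base = tail x ; closed-trail = O.closed-trail
    ; unique = O.unique ; sound = O.sound ; f-closed = O.f-closed }
    where module O = Orbit px

  splice : (C : Partial) {w c : E} (pw : P w) → w ∉ Partial.edges C →
           (X Y : List E) → Partial.edges C ≡ X ++ c ∷ Y → tail c ≡ tail w →
           Σ Partial λ C′ → Partial.edges C′ ↭ Orbit.edges pw ++ Partial.edges C
  splice C {w} {c} pw w∉C X Y C≡ tc≡tw
    with trail-split X (c ∷ Y) (subst (λ es → Trail (Partial.base C) es (Partial.base C)) C≡
                                      (Partial.closed-trail C))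
  ... | v , before-c , from-c@(tc≡v , _) = record
    { edges        = X ++ O.edges ++ c ∷ Y
    ; base         = base
    ; closed-trail = trail-++ X before-c (trail-++ O.edges orbit-trail from-c)
    ; unique       = unique-↭ (↭-sym perm) (Unique.++⁺ O.unique unique disjoint)
    ; sound        = λ y∈ → [ O.sound , sound ]′ (split-∈ y∈)
    ; f-closed     = λ y∈ → ∈-resp-↭ (↭-sym perm)
                              ([ ∈-++⁺ˡ ∘ O.f-closed , ∈-++⁺ʳ O.edges ∘ f-closed ]′ (split-∈ y∈))
    } , perm
    where
    open Partial C
    module O = Orbit pw

    perm : X ++ O.edges ++ c ∷ Y ↭ O.edges ++ edges
    perm = subst (λ es → X ++ O.edges ++ c ∷ Y ↭ O.edges ++ es) (sym C≡) (shifts X O.edges)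

    split-∈ : ∀ {y} → y ∈ X ++ O.edges ++ c ∷ Y → y ∈ O.edges ⊎ y ∈ edges
    split-∈ y∈ = ∈-++⁻ O.edges (∈-resp-↭ perm y∈)

    -- the orbit of w misses C: from C one never reaches w by f-steps
    disjoint : Disjoint O.edges edges
    disjoint (y∈O , y∈C) with O.leads-back y∈O
    ... | j , fʲy≡w = w∉C (subst (_∈ edges) fʲy≡w (iterate-preserves {Q = _∈ edges} f f-closed j y∈C))

    orbit-trail : Trail v O.edges v
    orbit-trail = subst (λ u → Trail u O.edges u) (trans (sym tc≡tw) tc≡v) O.closed-trail

  Extends : List E → E → Set
  Extends es w = P w × w ∉ es × Any (λ c → tail c ≡ tail w) es

  extends? : ∀ es → Decidable (Extends es)
  extends? es w = P? w ×-dec ¬? (w ∈? es) ×-dec any? (λ c → tail c ≟ᵥ tail w) es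

  saturated : Connected → (C : Partial) → ¬ Any (Extends (Partial.edges C)) enum →
              ∀ {x₀} → x₀ ∈ Partial.edges C → ∀ x → P x → x ∈ Partial.edges C
  saturated connected C stuck x₀∈ x px =
    connected (_∈ edges) (λ _ → f-closed) tail-closed (sound x₀∈) px x₀∈
    where
    open Partial C
    tail-closed : ∀ {x y} → P x → P y → tail x ≡ tail y → x ∈ edges → y ∈ edges
    tail-closed {y = y} _ py tx≡ty x∈ with y ∈? edges
    ... | yes y∈ = y∈
    ... | no  y∉ = ⊥-elim (stuck (lose (enum-complete py) (py , y∉ , lose x∈ tx≡ty)))

  -- Each
  -- splice adds at least one edge and C never exceeds enum, so `fuel`, an upper
  -- bound on the number of missing edges, suffices.
  grow : Connected → ∀ fuel (C : Partial) → length enum < length (Partial.edges C) + fuel →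
         ∀ {x₀} → x₀ ∈ Partial.edges C → Σ (List E) IsEulerianCycle
  grow connected zero C bound _ =
    ⊥-elim (<⇒≱ (subst (length enum <_) (+-identityʳ _) bound)
                (unique-⊆-length unique (enum-complete ∘ sound)))
    where open Partial C
  grow connected (suc fuel) C bound x₀∈ with any? (extends? (Partial.edges C)) enum
  ... | yes ext =
    let w , _ , pw , w∉C , shares = find ext
        c , c∈C , tc≡tw          = find shares
        X , Y , C≡               = ∈-∃++ c∈C
        C′ , perm                = splice C pw w∉C X Y C≡ tc≡tw
        longer : suc (length (Partial.edges C)) ≤ length (Partial.edges C′)
        longer = subst (suc (length (Partial.edges C)) ≤_)
                       (sym (trans (↭-length perm) (length-++ (Orbit.edges pw))))
                       (s≤s (m≤n+m _ _))
    in grow connected fuel C′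
         (<-≤-trans bound (≤-trans (≤-reflexive (+-suc _ fuel)) (+-monoˡ-≤ fuel longer)))
         (∈-resp-↭ (↭-sym perm) (∈-++⁺ʳ (Orbit.edges pw) x₀∈))
  ... | no stuck = edges , unique , tabulate sound , saturated connected C stuck x₀∈ ,
                   closed-trail-cyclic edges closed-trail
    where open Partial C

  eulerian-cycle : Connected → ∀ {x₀} → P x₀ → Σ (List E) IsEulerianCycle
  eulerian-cycle connected {x₀} px₀ =
    grow connected (suc (length enum)) (orbit-partial px₀)
         (m≤n+m (suc (length enum)) (length (Orbit.edges px₀))) (here refl)

inverse-mod : ∀ m k → 2 ≤ k → Coprime m k → ∃₂ λ j q → j * m ≡ 1 + q * k
inverse-mod m (suc zero) (s≤s ()) _
inverse-mod m (suc (suc k)) _ coprime with coprime-Bézout coprime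
... | Bézout.+- x y eq       = x , y , sym eq
... | Bézout.-+ x zero ()
... | Bézout.-+ x (suc y) eq =
  -- 1 + x·m ≡ (1+y)·(k+2); multiplying by k+1 ≡ -1 (mod k+2) inverts x·m
  x * suc k , k + y * suc k , +-cancelʳ-≡ (suc k) _ _ (begin
    x * suc k * m + suc k               ≡⟨ factor x k m ⟩
    suc k * (1 + x * m)                 ≡⟨ cong (suc k *_) eq ⟩
    suc k * (suc y * suc (suc k))       ≡⟨ expand y k ⟩
    1 + (k + y * suc k) * suc (suc k) + suc k ∎)
  where
  open ≡-Reasoning
  factor : ∀ x k m → x * suc k * m + suc k ≡ suc k * (1 + x * m)
  factor = solve-∀
  expand : ∀ y k → suc k * (suc y * suc (suc k)) ≡ 1 + (k + y * suc k) * suc (suc k) + suc k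
  expand = solve-∀

coprime-complement : ∀ {s k} → s ≤ k → Coprime s k → Coprime (k ∸ s) k
coprime-complement s≤k coprime (d∣k∸s , d∣k) =
  coprime (∣m+n∣m⇒∣n (subst (_ ∣_) (sym (m∸n+n≡m s≤k)) d∣k) d∣k∸s , d∣k)

words : (n m : ℕ) → List (List (Fin n))
words n zero    = [ [] ]
words n (suc m) = concatMap (λ a → map (a ∷_) (words n m)) (allFin n)

∈-words : ∀ {n} m (w : List (Fin n)) → length w ≡ m → w ∈ words n m
∈-words zero    []      refl = here refl
∈-words (suc m) (a ∷ w) refl =
  ∈-concat⁺′ (∈-map⁺ (a ∷_) (∈-words m w refl)) (∈-map⁺ (λ b → map (b ∷_) (words _ m)) (∈-allFin a))

isKPerm? : ∀ n k (w : List (Fin n)) → Dec (IsKPerm n k w)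
isKPerm? n k w = (length w ≟ k) ×-dec unique? w
  where open import Data.List.Relation.Unary.Unique.DecPropositional (_≟ᶠ_ {n}) using (unique?)

-- The permutation σ of k-permutations whose orbits are closed s-overlap trails:
-- σ moves the first k − s letters to the end, so the last s letters of w
-- become the first s letters of σ w.
module Successor (n k s : ℕ) (s≤k : s ≤ k) where

  σ : List (Fin n) → List (Fin n)
  σ = rotate (k ∸ s)

  σ-IsKPerm : ∀ {w} → IsKPerm n k w → IsKPerm n k (σ w)
  σ-IsKPerm {w} = ↭-IsKPerm (rotate-↭ (k ∸ s) w)

  σ-link : ∀ {w} → IsKPerm n k w → drop (k ∸ s) w ≡ take s (σ w)
  σ-link {w} (len , _) = sym (begin
    take s (σ w)              ≡⟨ cong (take s) (rotate-split (k ∸ s) w k∸s≤) ⟩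
    take s (D ++ T)           ≡⟨ cong (λ i → take i (D ++ T)) (sym len-D) ⟩
    take (length D) (D ++ T)  ≡⟨ take-++ D T ⟩
    D                         ∎)
    where
    open ≡-Reasoning
    D T : List (Fin n)
    D = drop (k ∸ s) w
    T = take (k ∸ s) w
    k∸s≤ : k ∸ s ≤ length w
    k∸s≤ = subst (k ∸ s ≤_) (sym len) (m∸n≤m k s)
    len-D : length D ≡ s
    len-D = trans (length-drop (k ∸ s) w) (trans (cong (_∸ (k ∸ s)) len) (m∸[m∸n]≡n s≤k))

  iterate-σ : ∀ j w → iterate σ w j ≡ rotate (j * (k ∸ s)) w
  iterate-σ j w = iterate-* rotate₁ (k ∸ s) w j

  σ-periodic : ∀ {w} → IsKPerm n k w → iterate σ w k ≡ w
  σ-periodic {w} (len , _) = begin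
    iterate σ w k                ≡⟨ iterate-σ k w ⟩
    rotate (k * (k ∸ s)) w       ≡⟨ cong (λ i → rotate i w) (*-comm k (k ∸ s)) ⟩
    rotate ((k ∸ s) * k) w       ≡⟨ cong (λ i → rotate ((k ∸ s) * i) w) (sym len) ⟩
    rotate ((k ∸ s) * length w) w ≡⟨ rotate-multiple (k ∸ s) w ⟩
    w                            ∎
    where open ≡-Reasoning

-- If R is preserved by replacing one letter of an
-- m-permutation of [n] by a letter that does not occur in it, and m < n, then
-- R holds for all m-permutations as soon as it holds for one: fix the target
-- letter by letter, first moving a clashing later occurrence to a fresh letter.
module ReplacementWalk {n m : ℕ} (m<n : m < n) (R : List (Fin n) → Set)
  (replace : ∀ X {x y} Y → IsKPerm n m (X ++ x ∷ Y) → y ∉ X ++ Y → R (X ++ x ∷ Y) → R (X ++ y ∷ Y))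
  where

  open import Data.List.Membership.DecPropositional (_≟ᶠ_ {n}) using (_∈?_)

  Good : List (Fin n) → Set
  Good w = IsKPerm n m w × R w

  replace-Good : ∀ X {x y} Y → y ∉ X ++ Y → Good (X ++ x ∷ Y) → Good (X ++ y ∷ Y)
  replace-Good X Y y∉ (kp , r) = replace-IsKPerm X Y kp y∉ , replace X Y kp y∉ r

  step : ∀ X x B y → y ∉ X → Good (X ++ x ∷ B) → ∃ λ B′ → Good (X ++ y ∷ B′)
  step X x B y y∉X g with y ∈? B
  ... | no y∉B = B , replace-Good X B y∉XB g
    where
    y∉XB : y ∉ X ++ B
    y∉XB y∈ = [ y∉X , y∉B ]′ (∈-++⁻ X y∈)
  ... | yes y∈B with ∈-∃++ y∈B
  ...   | B₁ , B₂ , refl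
    with fresh-letter (X ++ x ∷ B₁ ++ y ∷ B₂) (subst (_< n) (sym (proj₁ (proj₁ g))) m<n)
  ...     | a , a∉w = B₁ ++ a ∷ B₂ , replace-Good X (B₁ ++ a ∷ B₂) y∉ moved
    where
    Xx : List (Fin n)
    Xx = X ++ x ∷ B₁
    reassoc : ∀ c → Xx ++ c ∷ B₂ ≡ X ++ x ∷ B₁ ++ c ∷ B₂
    reassoc c = ++-assoc X (x ∷ B₁) (c ∷ B₂)
    moved : Good (X ++ x ∷ B₁ ++ a ∷ B₂)
    moved = subst Good (reassoc a)
              (replace-Good Xx B₂ (λ a∈ → a∉w (subst (a ∈_) (reassoc y) (∈-middle⁺ Xx B₂ a∈)))
                            (subst Good (sym (reassoc y)) g))
    y≢a : y ≢ a
    y≢a y≡a = a∉w (subst (_∈ X ++ x ∷ B₁ ++ y ∷ B₂) y≡a (∈-++⁺ʳ X (there (∈-++⁺ʳ B₁ (here refl)))))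
    y∉B₁B₂ : y ∉ B₁ ++ B₂
    y∉B₁B₂ y∈ = proj₁ (unique-middle⁻ Xx B₂ (subst Unique (sym (reassoc y)) (proj₂ (proj₁ g))))
                  ([ (λ y∈B₁ → ∈-++⁺ˡ (∈-++⁺ʳ X (there y∈B₁))) , ∈-++⁺ʳ Xx ]′ (∈-++⁻ B₁ y∈))
    y∉ : y ∉ X ++ B₁ ++ a ∷ B₂
    y∉ y∈ = [ y∉X , (λ y∈B → y∉B₁B₂ (∈-middle⁻ B₁ B₂ y∈B y≢a)) ]′ (∈-++⁻ X y∈)

  tails-differ : ∀ (X : List (Fin n)) y T → length (X ++ []) ≢ length (X ++ y ∷ T)
  tails-differ X y T e with +-cancelˡ-≡ (length X) _ _ (trans (sym (length-++ X)) (trans e (length-++ X)))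
  ... | ()

  walk-from : ∀ X B T → IsKPerm n m (X ++ T) → Good (X ++ B) → R (X ++ T)
  walk-from X []      []      _  (_ , r) = r
  walk-from X []      (y ∷ T) kt (kp , _) = ⊥-elim (tails-differ X y T (trans (proj₁ kp) (sym (proj₁ kt))))
  walk-from X (x ∷ B) []      kt (kp , _) = ⊥-elim (tails-differ X x B (trans (proj₁ kt) (sym (proj₁ kp))))
  walk-from X (x ∷ B) (y ∷ T) kt g with step X x B y y∉X g
    where
    y∉X : y ∉ X
    y∉X y∈X = proj₁ (unique-middle⁻ X T (proj₂ kt)) (∈-++⁺ˡ y∈X)
  ... | B′ , g′ = subst R (++-assoc X [ y ] T)
                    (walk-from (X ++ [ y ]) B′ T (subst (IsKPerm n m) (sym (++-assoc X [ y ] T)) kt)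
                                                 (subst Good (sym (++-assoc X [ y ] B′)) g′))

  walk : ∀ {u t} → IsKPerm n m u → IsKPerm n m t → R u → R t
  walk {u} {t} ku kt r = walk-from [] u t kt (ku , r)

-- The k-permutations of [n] as edges from their s-prefix to their s-suffix,
-- with the cycle decomposition given by σ; an Eulerian cycle of this edge
-- set is exactly an s-overlap cycle.
module OverlapCycle (n k s : ℕ) (s≤k : s ≤ k) (k≥1 : 1 ≤ k) where
  open Successor n k s s≤k public

  σ-period : ∀ {w} → IsKPerm n k w → iterate σ w (suc (k ∸ 1)) ≡ w
  σ-period {w} kp = subst (λ i → iterate σ w i ≡ w) (sym (m+[n∸m]≡n k≥1)) (σ-periodic kp)

  open EulerianCycle (≡-dec _≟ᶠ_) (≡-dec _≟ᶠ_) (take s) (drop (k ∸ s))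
         (IsKPerm n k) (isKPerm? n k) (words n k) (λ kp → ∈-words k _ (proj₁ kp))
         σ σ-IsKPerm σ-link (k ∸ 1) σ-period
    public using (Connected; eulerian-cycle)

  module Closed (S : List (Fin n) → Set)
    (σ-closed : ∀ {w} → IsKPerm n k w → S w → S (σ w))
    (prefix-closed : ∀ {w w′} → IsKPerm n k w → IsKPerm n k w′ → take s w ≡ take s w′ → S w → S w′)
    where

    module Short (short : s + s < k) (k<n : k < n) where

      Reach : List (Fin n) → Set
      Reach u = ∃ λ w → IsKPerm n k w × S w × take s w ≡ u

      prefix-IsKPerm : ∀ {w} → IsKPerm n k w → IsKPerm n s (take s w)
      prefix-IsKPerm {w} (len , u) =
        trans (length-take s w) (trans (cong (s ⊓_) len) (m≤n⇒m⊓n≡m s≤k)) , Unique.take⁺ s u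

      -- the gap between prefix and suffix of a k-permutation
      d : ℕ
      d = k ∸ s ∸ s

      s+d≡k∸s : s + d ≡ k ∸ s
      s+d≡k∸s = m+[n∸m]≡n (m+n≤o⇒m≤o∸n s (<⇒≤ short))

      gap-room : ∀ (u v : List (Fin n)) → length u ≡ s → length v ≡ s → d + length (u ++ v) ≤ n
      gap-room u v lu lv = subst (_≤ n) (sym (begin
        d + length (u ++ v)   ≡⟨ cong (d +_) (trans (length-++ u) (cong₂ _+_ lu lv)) ⟩
        d + (s + s)           ≡⟨ rearrange d s ⟩
        (s + d) + s           ≡⟨ cong (_+ s) s+d≡k∸s ⟩
        (k ∸ s) + s           ≡⟨ m∸n+n≡m s≤k ⟩
        k                     ∎)) (<⇒≤ k<n)
        where
        open ≡-Reasoning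
        rearrange : ∀ a b → a + (b + b) ≡ (b + a) + b
        rearrange = solve-∀

      -- from a prefix u to any disjoint prefix v, via the word u ++ z ++ v (z fresh) and σ
      jump : ∀ {u v} → Reach u → IsKPerm n s v → Disjoint u v → Reach v
      jump {v = v} (w , kw , Sw , refl) (lv , uv) u#v
        with fresh-word d (take s w ++ v) (gap-room (take s w) v (proj₁ (prefix-IsKPerm kw)) lv)
      ... | z , (lz , uz) , z#uv = σ w₁ , σ-IsKPerm kw₁ , σ-closed kw₁ Sw₁ , prefix-σw₁
        where
        u : List (Fin n)
        u = take s w
        lu : length u ≡ s
        lu = proj₁ (prefix-IsKPerm kw)
        w₁ : List (Fin n)
        w₁ = (u ++ z) ++ v
        luz : length (u ++ z) ≡ k ∸ s
        luz = trans (length-++ u) (trans (cong₂ _+_ lu lz) s+d≡k∸s)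
        u#z : Disjoint u z
        u#z (a∈u , a∈z) = z#uv (a∈z , ∈-++⁺ˡ a∈u)
        uz#v : Disjoint (u ++ z) v
        uz#v (a∈uz , a∈v) =
          [ (λ a∈u → u#v (a∈u , a∈v)) , (λ a∈z → z#uv (a∈z , ∈-++⁺ʳ u a∈v)) ]′ (∈-++⁻ u a∈uz)
        kw₁ : IsKPerm n k w₁
        kw₁ = trans (length-++ (u ++ z)) (trans (cong₂ _+_ luz lv) (m∸n+n≡m s≤k)) ,
              Unique.++⁺ (Unique.++⁺ (proj₂ (prefix-IsKPerm kw)) uz u#z) uv uz#v
        Sw₁ : S w₁
        Sw₁ = prefix-closed kw kw₁ (sym (begin
          take s ((u ++ z) ++ v)         ≡⟨ cong (take s) (++-assoc u z v) ⟩
          take s (u ++ z ++ v)           ≡⟨ cong (λ i → take i (u ++ z ++ v)) (sym lu) ⟩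
          take (length u) (u ++ z ++ v)  ≡⟨ take-++ u (z ++ v) ⟩
          u                              ∎)) Sw
          where open ≡-Reasoning
        prefix-σw₁ : take s (σ w₁) ≡ v
        prefix-σw₁ = begin
          take s (σ w₁)                        ≡⟨ cong (λ i → take s (rotate i w₁)) (sym luz) ⟩
          take s (rotate (length (u ++ z)) w₁) ≡⟨ cong (take s) (rotate-++ (u ++ z) v) ⟩
          take s (v ++ u ++ z)                 ≡⟨ cong (λ i → take i (v ++ u ++ z)) (sym lv) ⟩
          take (length v) (v ++ u ++ z)        ≡⟨ take-++ v (u ++ z) ⟩
          v                                    ∎
          where open ≡-Reasoning

      replace-room : ∀ (u : List (Fin n)) y → length u ≡ s → s + length (y ∷ u) ≤ n
      replace-room u y lu = subst (λ i → s + suc i ≤ n) (sym lu)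
                            (≤-trans (≤-reflexive (+-suc s s)) (<-trans short k<n))

      -- replacing one letter of a reachable prefix: jump to a prefix v avoiding both
      replace-Reach : ∀ X {x y} Y → IsKPerm n s (X ++ x ∷ Y) → y ∉ X ++ Y →
                      Reach (X ++ x ∷ Y) → Reach (X ++ y ∷ Y)
      replace-Reach X {x} {y} Y ku y∉ r
        with fresh-word s (y ∷ X ++ x ∷ Y) (replace-room (X ++ x ∷ Y) y (proj₁ ku))
      ... | v , kv , v# = jump (jump r kv u#v) (replace-IsKPerm X Y ku y∉) v#u′
        where
        u#v : Disjoint (X ++ x ∷ Y) v
        u#v (a∈u , a∈v) = v# (a∈v , there a∈u)
        v#u′ : Disjoint v (X ++ y ∷ Y)
        v#u′ (a∈v , a∈u′) with ∈-resp-↭ (shift y X Y) a∈u′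
        ... | here a≡y    = v# (a∈v , here a≡y)
        ... | there a∈XY = v# (a∈v , there (∈-middle⁺ X Y a∈XY))

      open ReplacementWalk (≤-<-trans (≤-trans (m≤m+n s s) (<⇒≤ short)) k<n) Reach replace-Reach

      spread : ∀ {w t} → IsKPerm n k w → IsKPerm n k t → S w → S t
      spread kw kt Sw with walk (prefix-IsKPerm kw) (prefix-IsKPerm kt) (_ , kw , Sw , refl)
      ... | w′ , kw′ , Sw′ , prefix≡ = prefix-closed kw′ kt prefix≡ Sw′

    -- Case σʲ = rotate₁ (k − s invertible mod k) and s < k: every letter can be
    -- rotated to the last position, outside the prefix, and replaced there.
    module Invertible (j q : ℕ) (inverse : j * (k ∸ s) ≡ 1 + q * k) (s<k : s < k) (k<n : k < n) where

      KS : List (Fin n) → Set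
      KS w = IsKPerm n k w × S w

      rotate₁-KS : ∀ {w} → KS w → KS (rotate₁ w)
      rotate₁-KS {w} ks = subst KS σʲw≡rotate₁w
        (iterate-preserves {Q = KS} σ (λ (kp , Sw) → σ-IsKPerm kp , σ-closed kp Sw) j ks)
        where
        open ≡-Reasoning
        len : length (rotate₁ w) ≡ k
        len = proj₁ (↭-IsKPerm (rotate-↭ 1 w) (proj₁ ks))
        σʲw≡rotate₁w : iterate σ w j ≡ rotate₁ w
        σʲw≡rotate₁w = begin
          iterate σ w j                                  ≡⟨ iterate-σ j w ⟩
          rotate (j * (k ∸ s)) w                         ≡⟨ cong (λ i → rotate i w) inverse ⟩
          rotate (q * k) (rotate₁ w)                     ≡⟨ cong (λ i → rotate (q * i) (rotate₁ w)) (sym len) ⟩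
          rotate (q * length (rotate₁ w)) (rotate₁ w)    ≡⟨ rotate-multiple q (rotate₁ w) ⟩
          rotate₁ w                                      ∎

      swap-KS : ∀ X Y → KS (X ++ Y) → KS (Y ++ X)
      swap-KS X Y ks = subst KS (rotate-++ X Y) (iterate-preserves {Q = KS} rotate₁ rotate₁-KS (length X) ks)

      to-back : ∀ X x Y → KS (X ++ x ∷ Y) → KS ((Y ++ X) ++ [ x ])
      to-back X x Y ks =
        subst KS (sym (++-assoc Y X [ x ])) (swap-KS (X ++ [ x ]) Y (subst KS (sym (++-assoc X [ x ] Y)) ks))

      to-front : ∀ X x Y → KS ((Y ++ X) ++ [ x ]) → KS (X ++ x ∷ Y)
      to-front X x Y ks =
        subst KS (++-assoc X [ x ] Y) (swap-KS Y (X ++ [ x ]) (subst KS (++-assoc Y X [ x ]) ks))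

      back-↭ : ∀ X (x : Fin n) Y → X ++ x ∷ Y ↭ (Y ++ X) ++ [ x ]
      back-↭ X x Y = subst₂ _↭_ (++-assoc X [ x ] Y) (sym (++-assoc Y X [ x ])) (++-comm (X ++ [ x ]) Y)

      -- in the last position, x lies outside the s-prefix and can be replaced
      replace-S : ∀ X {x y} Y → IsKPerm n k (X ++ x ∷ Y) → y ∉ X ++ Y → S (X ++ x ∷ Y) → S (X ++ y ∷ Y)
      replace-S X {x} {y} Y kp y∉ Sw = proj₂ (to-front X y Y (kp′ , S′))
        where
        rotated : KS ((Y ++ X) ++ [ x ])
        rotated = to-back X x Y (kp , Sw)
        kp′ : IsKPerm n k ((Y ++ X) ++ [ y ])
        kp′ = ↭-IsKPerm (back-↭ X y Y) (replace-IsKPerm X Y kp y∉)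
        s≤ : s ≤ length (Y ++ X)
        s≤ = ≤-pred (subst (s <_) (trans (sym (proj₁ kp′)) (trans (length-++ (Y ++ X)) (+-comm _ 1))) s<k)
        S′ : S ((Y ++ X) ++ [ y ])
        S′ = prefix-closed (proj₁ rotated) kp′
               (trans (take-++-≤ s (Y ++ X) [ x ] s≤) (sym (take-++-≤ s (Y ++ X) [ y ] s≤))) (proj₂ rotated)

      spread : ∀ {w t} → IsKPerm n k w → IsKPerm n k t → S w → S t
      spread = ReplacementWalk.walk k<n S replace-S

  connected-short : s + s < k → k < n → Connected
  connected-short short k<n S σ-closed prefix-closed =
    Closed.Short.spread S σ-closed prefix-closed short k<n

  connected-coprime : Coprime s k → 1 ≤ s → s < k → k < n → Connected
  connected-coprime coprime 1≤s s<k k<n S σ-closed prefix-closed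
    with inverse-mod (k ∸ s) k (≤-trans (s≤s 1≤s) s<k) (coprime-complement s≤k coprime)
  ... | j , q , inverse = Closed.Invertible.spread S σ-closed prefix-closed j q inverse s<k k<n

initial-IsKPerm : ∀ {n k} → k ≤ n → IsKPerm n k (take k (allFin n))
initial-IsKPerm {n} {k} k≤n =
  trans (length-take k (allFin n)) (trans (cong (k ⊓_) (length-tabulate (λ a → a))) (m≤n⇒m⊓n≡m k≤n)) ,
  Unique.take⁺ k (Unique.allFin⁺ n)

mainTheorem3 : (n s k : ℕ) → 1 ≤ n → 1 ≤ s → 1 ≤ k → k < n →
    ((2 * s < k) ⊎ ((gcd s k ≡ 1) × (k ≤ 2 * s) × (s < k ∸ 1))) →
    Σ (List (List (Fin n))) (λ cs → IsOCycle k s (IsKPerm n k) cs)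
-- The hypothesis k ≤ 2s only separates the two cases; the coprime case does
-- not need it.
mainTheorem3 n s k _ 1≤s 1≤k k<n condition = eulerian-cycle connected (initial-IsKPerm (<⇒≤ k<n))
  where
  s<k : s < k
  s<k = [ (λ 2s<k → ≤-<-trans (m≤m+n s (s + 0)) 2s<k)
        , (λ (_ , _ , s<k∸1) → <-≤-trans s<k∸1 (m∸n≤m k 1)) ]′ condition
  open OverlapCycle n k s (<⇒≤ s<k) 1≤k
  connected : Connected
  connected = [ (λ 2s<k → connected-short (subst (_< k) (cong (s +_) (+-identityʳ s)) 2s<k) k<n)
              , (λ (gcd≡1 , _ , s<k∸1) → connected-coprime (gcd≡1⇒coprime gcd≡1) 1≤s s<k k<n) ]′ condition
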